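{- Let $\mathcal{T}$ be a robust tangle of order $k$ in a connectivity system $K=(E,\lambda)$ and let $X\in\mathcal{T}$. Let $\mathcal{T}'$ be the collection of subsets of $(E-X)\cup\{x\}$ such that for all $A\subseteq E-X$: $A\in\mathcal{T}'$ if and only if $A\in\mathcal{T}$, and $A\cup\{x\}\in\mathcal{T}'$ if and only if $A\cup X\in\mathcal{T}$. Then $\mathcal{T}'$ is a robust tangle of order $k$ in $K\circ X$.
   Context: A connectivity system is a pair $(E,\lambda)$ with $E$ finite and $\lambda$ an integer-valued, symmetric ($\lambda(X)=\lambda(E-X)$), submodular function on subsets of $E$. For $X\subseteq E$ and a new element $x\notin E$, $K\circ X=((E-X)\cup\{x\},\lambda')$ where for $A\subseteq E-X$, $\lambda'(A)=\lambda(A)$ and $\lambda'(A\cup\{x\})=\lambda(A\cup X)$; this is a connectivity system. A tangle of order $k$ in $(E,\lambda)$ is a collection $\mathcal{T}$ of subsets of $E$ with: (T1) $\lambda(A)<k$ for all $A\in\mathcal{T}$; (T2) if $\lambda(A)\le k-1$ then $A\in\mathcal{T}$ or $E-A\in\mathcal{T}$; (T3) if $A,B,C\in\mathcal{T}$ then $A\cup B\cup C\ne E$; (T4) $E-\{e\}\notin\mathcal{T}$ for each $e\in E$. It is robust if in addition no eight members $A_1,\ldots,A_8$ of $\mathcal{T}$ satisfy $A_1\cup\cdots\cup A_8=E$. -}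

module Defs where

open import Data.Bool using (Bool; true; false; if_then_else_)
open import Data.Nat using (ℕ)
open import Data.Fin using (Fin)
open import Data.Fin.Subset using (Subset; _∈_; _∉_; _⊆_; _∪_; _∩_; _─_; _-_; ⁅_⁆; ⋃; ⊥)
open import Data.Integer using (ℤ; _+_; _≤_; _<_; 1ℤ)
import Data.Integer as ℤ
open import Data.Vec using (lookup)
open import Data.List using (List; []; _∷_)
open import Data.Product using (_×_)
open import Data.Sum using (_⊎_)
open import Relation.Binary.PropositionalEquality using (_≡_; _≢_)
open import Relation.Nullary using (¬_)

-- Convention: all ground sets live inside a fixed finite universe Fin N,
-- and a ground set E is a subset E ⊆ Fin N.  A subset of E is a
-- Subset N that is ⊆ E.  The connectivity function is given on all of
-- Subset N, but only its values on subsets of E matter.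

record ConnectivitySystem (N : ℕ) : Set where
  field
    E : Subset N
    conn : Subset N → ℤ
    symmetric : ∀ A → A ⊆ E → conn A ≡ conn (E ─ A)
    submodular : ∀ A B → A ⊆ E → B ⊆ E →
      conn (A ∪ B) + conn (A ∩ B) ≤ conn A + conn B

record IsTangle {N : ℕ} (E : Subset N) (conn : Subset N → ℤ) (k : ℤ)
                (𝒯 : Subset N → Set) : Set where
  field
    members⊆E : ∀ A → 𝒯 A → A ⊆ E
    T1 : ∀ A → 𝒯 A → conn A < k
    T2 : ∀ A → A ⊆ E → conn A ≤ k ℤ.- 1ℤ → 𝒯 A ⊎ 𝒯 (E ─ A)
    T3 : ∀ A B C → 𝒯 A → 𝒯 B → 𝒯 C → A ∪ B ∪ C ≢ E
    T4 : ∀ e → e ∈ E → ¬ 𝒯 (E - e)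

record IsRobustTangle {N : ℕ} (E : Subset N) (conn : Subset N → ℤ) (k : ℤ)
                      (𝒯 : Subset N → Set) : Set where
  field
    tangle : IsTangle E conn k 𝒯
    robust : ∀ A₁ A₂ A₃ A₄ A₅ A₆ A₇ A₈ →
      𝒯 A₁ → 𝒯 A₂ → 𝒯 A₃ → 𝒯 A₄ → 𝒯 A₅ → 𝒯 A₆ → 𝒯 A₇ → 𝒯 A₈ →
      A₁ ∪ A₂ ∪ A₃ ∪ A₄ ∪ A₅ ∪ A₆ ∪ A₇ ∪ A₈ ≢ E

-- K ∘ X, with the new element x taken from the universe outside E.
-- Ground set (E - X) ∪ {x}.
∘-ground : {N : ℕ} → Subset N → Subset N → Fin N → Subset N
∘-ground E X x = (E ─ X) ∪ ⁅ x ⁆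

∘-conn : {N : ℕ} → (Subset N → ℤ) → Subset N → Fin N → Subset N → ℤ
∘-conn conn X x A =
  if lookup A x then conn ((A - x) ∪ X) else conn A

∘-tangle : {N : ℕ} → Subset N → (Subset N → Set) → Subset N → Fin N →
           Subset N → Set
∘-tangle E 𝒯 X x B =
  B ⊆ ∘-ground E X x × (if lookup B x then 𝒯 ((B - x) ∪ X) else 𝒯 B)

-- Expanding x back into X maps subsets B of (E - X) ∪ {x} to subsets of E, and
-- by definition λ'(B) = λ(expand B) and B ∈ 𝒯' iff expand B ∈ 𝒯.  Expansion
-- preserves unions, sends the ground set to E and complements to complements, so
-- any tangle pulls back along it: T1 and T2 transfer directly, and members of 𝒯'
-- covering the new ground set would expand to members of 𝒯 covering E, which
-- gives T3 and robustness.  For T4, removing x from the ground set expands to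
-- E - X, the complement of the member X, and removing any other e gives E - e.
module Submission where

open import Defs
open import Data.Bool using (true; false; if_then_else_)
open import Data.Bool.Properties using (if-float)
open import Data.Empty using (⊥-elim)
open import Data.Fin using (Fin; zero; _≟_)
open import Data.Fin.Subset using (Subset; inside; _∈_; _∉_; _⊆_; _∪_; _─_; _-_; ⁅_⁆)
open import Data.Fin.Subset.Properties
  using (_∈?_; ⊆-antisym; p⊆p∪q; q⊆p∪q; x∈p∪q⁺; x∈p∪q⁻; p─q⊆p; x∈p∧x∉q⇒x∈p─q;
         x∈p∧x≢y⇒x∈p-y; x∈⁅x⁆; x∈⁅y⁆⇒x≡y; x∉⁅y⁆⇒x≢y; ∪-assoc; ∪-idem)
open import Data.Integer using (ℤ; _<_; _≤_; 1ℤ)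
import Data.Integer as ℤ
open import Data.Nat using (ℕ)
open import Data.Product using (_×_; _,_; proj₁; proj₂)
open import Data.Sum using (_⊎_; inj₁; inj₂; [_,_]; [_,_]′)
open import Data.Vec using (_∷_; lookup; there)
open import Data.Vec.Properties using ([]=⇒lookup; lookup⇒[]=)
open import Function using (id; case_of_)
open import Relation.Binary.PropositionalEquality
  using (_≡_; _≢_; refl; sym; trans; cong; subst; module ≡-Reasoning)
open import Relation.Nullary using (¬_; yes; no)

x∈p─q⁻ : ∀ {n} {x : Fin n} (p q : Subset n) → x ∈ p ─ q → x ∈ p × x ∉ q
x∈p─q⁻ p q x∈p─q = p─q⊆p p q x∈p─q , ∉q p q x∈p─q
  where
  ∉q : ∀ {n} {x : Fin n} (p q : Subset n) → x ∈ p ─ q → x ∉ q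
  ∉q (_ ∷ p) (_ ∷ q) (there x∈p─q) (there x∈q) = ∉q p q x∈p─q x∈q
  ∉q {x = zero} (_ ∷ p) (inside ∷ q) ()

x∈p-y⁻ : ∀ {n} {x y : Fin n} (p : Subset n) → x ∈ p - y → x ∈ p × x ≢ y
x∈p-y⁻ {y = y} p x∈p-y with x∈p─q⁻ p ⁅ y ⁆ x∈p-y
... | x∈p , x∉⁅y⁆ = x∈p , x∉⁅y⁆⇒x≢y x∉⁅y⁆

x∈p⇒⁅x⁆⊆p : ∀ {n} {x : Fin n} {p : Subset n} → x ∈ p → ⁅ x ⁆ ⊆ p
x∈p⇒⁅x⁆⊆p {x = x} {p} x∈p y∈⁅x⁆ = subst (_∈ p) (sym (x∈⁅y⁆⇒x≡y x y∈⁅x⁆)) x∈p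

p⊆q⇒p∪[q─p]≡q : ∀ {n} {p q : Subset n} → p ⊆ q → p ∪ (q ─ p) ≡ q
p⊆q⇒p∪[q─p]≡q {p = p} {q} p⊆q = ⊆-antisym ⊆q q⊆
  where
  ⊆q : p ∪ (q ─ p) ⊆ q
  ⊆q i∈ = [ p⊆q , p─q⊆p q p ] (x∈p∪q⁻ p (q ─ p) i∈)
  q⊆ : q ⊆ p ∪ (q ─ p)
  q⊆ {i} i∈q with i ∈? p
  ... | yes i∈p = x∈p∪q⁺ (inj₁ i∈p)
  ... | no i∉p = x∈p∪q⁺ (inj₂ (x∈p∧x∉q⇒x∈p─q i∈q i∉p))

complement-∉ : ∀ {N} {E : Subset N} {conn : Subset N → ℤ} {k} {𝒯 : Subset N → Set} {A} →
               IsTangle E conn k 𝒯 → 𝒯 A → ¬ 𝒯 (E ─ A)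
complement-∉ {E = E} {A = A} 𝒯-tangle 𝒯A 𝒯[E─A] = T3 A A (E ─ A) 𝒯A 𝒯A 𝒯[E─A] cover
  where
  open IsTangle 𝒯-tangle
  open ≡-Reasoning
  cover : A ∪ A ∪ (E ─ A) ≡ E
  cover = begin
    A ∪ A ∪ (E ─ A)   ≡⟨ ∪-assoc A A (E ─ A) ⟨
    (A ∪ A) ∪ (E ─ A) ≡⟨ cong (_∪ (E ─ A)) (∪-idem A) ⟩
    A ∪ (E ─ A)       ≡⟨ p⊆q⇒p∪[q─p]≡q (members⊆E A 𝒯A) ⟩
    E                 ∎

module Pullback
  {N : ℕ} {E E' : Subset N} {conn conn' : Subset N → ℤ} {k : ℤ} {𝒯 𝒯' : Subset N → Set}
  (𝒯-robust : IsRobustTangle E conn k 𝒯)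
  (f : Subset N → Subset N)
  (f-∪ : ∀ A B → f (A ∪ B) ≡ f A ∪ f B)
  (f-ground : f E' ≡ E)
  (f-─ : ∀ {A} → A ⊆ E' → f (E' ─ A) ≡ E ─ f A)
  (f-removal-∉ : ∀ {e} → e ∈ E' → ¬ 𝒯 (f (E' - e)))
  (conn'≡conn∘f : ∀ A → conn' A ≡ conn (f A))
  (𝒯'≡ : ∀ A → 𝒯' A ≡ (A ⊆ E' × 𝒯 (f A)))
  where

  open IsRobustTangle 𝒯-robust
  open IsTangle tangle

  to : ∀ {A} → 𝒯' A → A ⊆ E' × 𝒯 (f A)
  to {A} = subst id (𝒯'≡ A)

  from : ∀ {A} → A ⊆ E' → 𝒯 (f A) → 𝒯' A
  from {A} A⊆E' 𝒯fA = subst id (sym (𝒯'≡ A)) (A⊆E' , 𝒯fA)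

  f-⊆ : ∀ {A} → A ⊆ E' → f A ⊆ E
  f-⊆ {A} A⊆E' = subst (f A ⊆_) fA∪f[E'─A]≡E (p⊆p∪q (f (E' ─ A)))
    where
    open ≡-Reasoning
    fA∪f[E'─A]≡E : f A ∪ f (E' ─ A) ≡ E
    fA∪f[E'─A]≡E = begin
      f A ∪ f (E' ─ A) ≡⟨ f-∪ A (E' ─ A) ⟨
      f (A ∪ (E' ─ A)) ≡⟨ cong f (p⊆q⇒p∪[q─p]≡q A⊆E') ⟩
      f E'             ≡⟨ f-ground ⟩
      E                ∎

  f-∪ʳ : ∀ {A B C} → f B ≡ C → f (A ∪ B) ≡ f A ∪ C
  f-∪ʳ {A} {B} fB≡C = trans (f-∪ A B) (cong (f A ∪_) fB≡C)

  f-cover : ∀ {A B} → f A ≡ B → A ≡ E' → B ≡ E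
  f-cover fA≡B A≡E' = trans (sym fA≡B) (trans (cong f A≡E') f-ground)

  T2' : ∀ A → A ⊆ E' → conn' A ≤ k ℤ.- 1ℤ → 𝒯' A ⊎ 𝒯' (E' ─ A)
  T2' A A⊆E' λ'A≤k-1 with T2 (f A) (f-⊆ A⊆E') (subst (_≤ k ℤ.- 1ℤ) (conn'≡conn∘f A) λ'A≤k-1)
  ... | inj₁ 𝒯fA = inj₁ (from A⊆E' 𝒯fA)
  ... | inj₂ 𝒯[E─fA] = inj₂ (from (p─q⊆p E' A) (subst 𝒯 (sym (f-─ A⊆E')) 𝒯[E─fA]))

  isRobustTangle : IsRobustTangle E' conn' k 𝒯'
  isRobustTangle = record
    { tangle = record
      { members⊆E = λ A 𝒯'A → proj₁ (to 𝒯'A)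
      ; T1 = λ A 𝒯'A → subst (_< k) (sym (conn'≡conn∘f A)) (T1 (f A) (proj₂ (to 𝒯'A)))
      ; T2 = T2'
      ; T3 = λ A B C 𝒯'A 𝒯'B 𝒯'C A∪B∪C≡E' →
          T3 (f A) (f B) (f C) (proj₂ (to 𝒯'A)) (proj₂ (to 𝒯'B)) (proj₂ (to 𝒯'C))
             (f-cover (f-∪ʳ (f-∪ B C)) A∪B∪C≡E')
      ; T4 = λ e e∈E' 𝒯'[E'-e] → f-removal-∉ e∈E' (proj₂ (to 𝒯'[E'-e]))
      }
    ; robust = λ A₁ A₂ A₃ A₄ A₅ A₆ A₇ A₈ 𝒯'A₁ 𝒯'A₂ 𝒯'A₃ 𝒯'A₄ 𝒯'A₅ 𝒯'A₆ 𝒯'A₇ 𝒯'A₈ ⋃A≡E' →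
        robust (f A₁) (f A₂) (f A₃) (f A₄) (f A₅) (f A₆) (f A₇) (f A₈)
          (proj₂ (to 𝒯'A₁)) (proj₂ (to 𝒯'A₂)) (proj₂ (to 𝒯'A₃)) (proj₂ (to 𝒯'A₄))
          (proj₂ (to 𝒯'A₅)) (proj₂ (to 𝒯'A₆)) (proj₂ (to 𝒯'A₇)) (proj₂ (to 𝒯'A₈))
          (f-cover (f-∪ʳ (f-∪ʳ (f-∪ʳ (f-∪ʳ (f-∪ʳ (f-∪ʳ (f-∪ A₇ A₈))))))) ⋃A≡E')
    }

module Expansion {N : ℕ} (E X : Subset N) (x : Fin N) (X⊆E : X ⊆ E) (x∉E : x ∉ E) where

  E' : Subset N
  E' = ∘-ground E X x

  expand : Subset N → Subset N
  expand B = if lookup B x then (B - x) ∪ X else B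

  ∈E⇒≢x : ∀ {i} → i ∈ E → i ≢ x
  ∈E⇒≢x i∈E refl = x∉E i∈E

  x∈E' : x ∈ E'
  x∈E' = x∈p∪q⁺ (inj₂ (x∈⁅x⁆ x))

  ∈E'⁺ : ∀ {i} → i ∈ E → i ∉ X → i ∈ E'
  ∈E'⁺ i∈E i∉X = x∈p∪q⁺ (inj₁ (x∈p∧x∉q⇒x∈p─q i∈E i∉X))

  ∈E'⁻ : ∀ {i} → i ∈ E' → i ≢ x → i ∈ E × i ∉ X
  ∈E'⁻ i∈E' i≢x with x∈p∪q⁻ (E ─ X) ⁅ x ⁆ i∈E'
  ... | inj₁ i∈E─X = x∈p─q⁻ E X i∈E─X
  ... | inj₂ i∈⁅x⁆ = ⊥-elim (i≢x (x∈⁅y⁆⇒x≡y x i∈⁅x⁆))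

  expand-∈ : ∀ {B} → x ∈ B → expand B ≡ (B - x) ∪ X
  expand-∈ x∈B rewrite []=⇒lookup x∈B = refl

  expand-∉ : ∀ {B} → x ∉ B → expand B ≡ B
  expand-∉ {B} x∉B with lookup B x in Bx
  ... | true = ⊥-elim (x∉B (lookup⇒[]= x B Bx))
  ... | false = refl

  ∈-expand⁻ : ∀ {B i} → i ∈ expand B → (i ∈ B × i ≢ x) ⊎ (x ∈ B × i ∈ X)
  ∈-expand⁻ {B} {i} i∈ with x ∈? B
  ... | no x∉B = inj₁ (i∈B , λ { refl → x∉B i∈B })
    where
    i∈B : i ∈ B
    i∈B = subst (i ∈_) (expand-∉ x∉B) i∈
  ... | yes x∈B with x∈p∪q⁻ (B - x) X (subst (i ∈_) (expand-∈ x∈B) i∈)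
  ...   | inj₁ i∈B-x = inj₁ (x∈p-y⁻ B i∈B-x)
  ...   | inj₂ i∈X = inj₂ (x∈B , i∈X)

  ∈-expand⁺ˡ : ∀ {B i} → i ∈ B → i ≢ x → i ∈ expand B
  ∈-expand⁺ˡ {B} {i} i∈B i≢x with x ∈? B
  ... | yes x∈B = subst (i ∈_) (sym (expand-∈ x∈B)) (x∈p∪q⁺ (inj₁ (x∈p∧x≢y⇒x∈p-y i∈B i≢x)))
  ... | no x∉B = subst (i ∈_) (sym (expand-∉ x∉B)) i∈B

  ∈-expand⁺ʳ : ∀ {B i} → x ∈ B → i ∈ X → i ∈ expand B
  ∈-expand⁺ʳ {i = i} x∈B i∈X = subst (i ∈_) (sym (expand-∈ x∈B)) (x∈p∪q⁺ (inj₂ i∈X))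

  expand-mono : ∀ {B C} → B ⊆ C → expand B ⊆ expand C
  expand-mono B⊆C i∈ with ∈-expand⁻ i∈
  ... | inj₁ (i∈B , i≢x) = ∈-expand⁺ˡ (B⊆C i∈B) i≢x
  ... | inj₂ (x∈B , i∈X) = ∈-expand⁺ʳ (B⊆C x∈B) i∈X

  expand-∪ : ∀ B C → expand (B ∪ C) ≡ expand B ∪ expand C
  expand-∪ B C = ⊆-antisym ⊆∪ ∪⊆
    where
    ∪⊆ : expand B ∪ expand C ⊆ expand (B ∪ C)
    ∪⊆ i∈ = [ expand-mono (p⊆p∪q {p = B} C) , expand-mono (q⊆p∪q B C) ]′
              (x∈p∪q⁻ (expand B) (expand C) i∈)
    ⊆∪ : expand (B ∪ C) ⊆ expand B ∪ expand C
    ⊆∪ i∈ with ∈-expand⁻ i∈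
    ... | inj₁ (i∈B∪C , i≢x) =
      x∈p∪q⁺ ([ (λ i∈B → inj₁ (∈-expand⁺ˡ i∈B i≢x)) , (λ i∈C → inj₂ (∈-expand⁺ˡ i∈C i≢x)) ]
                (x∈p∪q⁻ B C i∈B∪C))
    ... | inj₂ (x∈B∪C , i∈X) =
      x∈p∪q⁺ ([ (λ x∈B → inj₁ (∈-expand⁺ʳ x∈B i∈X)) , (λ x∈C → inj₂ (∈-expand⁺ʳ x∈C i∈X)) ]
                (x∈p∪q⁻ B C x∈B∪C))

  expand-ground : expand E' ≡ E
  expand-ground = ⊆-antisym ⊆E E⊆
    where
    ⊆E : expand E' ⊆ E
    ⊆E i∈ with ∈-expand⁻ i∈
    ... | inj₁ (i∈E' , i≢x) = proj₁ (∈E'⁻ i∈E' i≢x)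
    ... | inj₂ (_ , i∈X) = X⊆E i∈X
    E⊆ : E ⊆ expand E'
    E⊆ {i} i∈E with i ∈? X
    ... | yes i∈X = ∈-expand⁺ʳ x∈E' i∈X
    ... | no i∉X = ∈-expand⁺ˡ (∈E'⁺ i∈E i∉X) (∈E⇒≢x i∈E)

  expand-─ : ∀ {B} → B ⊆ E' → expand (E' ─ B) ≡ E ─ expand B
  expand-─ {B} B⊆E' = ⊆-antisym ⊆E─ E─⊆
    where
    ⊆E─ : expand (E' ─ B) ⊆ E ─ expand B
    ⊆E─ i∈ with ∈-expand⁻ i∈
    ... | inj₁ (i∈E'─B , i≢x) with x∈p─q⁻ E' B i∈E'─B
    ...   | i∈E' , i∉B with ∈E'⁻ i∈E' i≢x
    ...     | i∈E , i∉X = x∈p∧x∉q⇒x∈p─q i∈E λ i∈fB → case ∈-expand⁻ i∈fB of λ where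
                (inj₁ (i∈B , _)) → i∉B i∈B
                (inj₂ (_ , i∈X)) → i∉X i∈X
    ⊆E─ i∈ | inj₂ (x∈E'─B , i∈X) =
      x∈p∧x∉q⇒x∈p─q (X⊆E i∈X) λ i∈fB → case ∈-expand⁻ i∈fB of λ where
                (inj₁ (i∈B , i≢x)) → proj₂ (∈E'⁻ (B⊆E' i∈B) i≢x) i∈X
                (inj₂ (x∈B , _)) → proj₂ (x∈p─q⁻ E' B x∈E'─B) x∈B
    E─⊆ : E ─ expand B ⊆ expand (E' ─ B)
    E─⊆ {i} i∈ with x∈p─q⁻ E (expand B) i∈ | i ∈? X
    ... | i∈E , i∉fB | yes i∈X =
      ∈-expand⁺ʳ (x∈p∧x∉q⇒x∈p─q x∈E' λ x∈B → i∉fB (∈-expand⁺ʳ x∈B i∈X)) i∈X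
    ... | i∈E , i∉fB | no i∉X =
      ∈-expand⁺ˡ (x∈p∧x∉q⇒x∈p─q (∈E'⁺ i∈E i∉X) λ i∈B → i∉fB (∈-expand⁺ˡ i∈B i≢x)) i≢x
      where
      i≢x : i ≢ x
      i≢x = ∈E⇒≢x i∈E

  expand-⁅x⁆ : expand ⁅ x ⁆ ≡ X
  expand-⁅x⁆ = ⊆-antisym ⊆X (∈-expand⁺ʳ (x∈⁅x⁆ x))
    where
    ⊆X : expand ⁅ x ⁆ ⊆ X
    ⊆X i∈ with ∈-expand⁻ i∈
    ... | inj₁ (i∈⁅x⁆ , i≢x) = ⊥-elim (i≢x (x∈⁅y⁆⇒x≡y x i∈⁅x⁆))
    ... | inj₂ (_ , i∈X) = i∈X

  expand-removal-∉ : ∀ {conn k 𝒯 e} → IsTangle E conn k 𝒯 → 𝒯 X → e ∈ E' → ¬ 𝒯 (expand (E' - e))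
  expand-removal-∉ {𝒯 = 𝒯} {e} 𝒯-tangle 𝒯X e∈E' 𝒯[f[E'-e]]
    with subst 𝒯 (expand-─ (x∈p⇒⁅x⁆⊆p e∈E')) 𝒯[f[E'-e]] | e ≟ x
  ... | 𝒯[E─f⁅x⁆] | yes refl =
    complement-∉ 𝒯-tangle 𝒯X (subst 𝒯 (cong (E ─_) expand-⁅x⁆) 𝒯[E─f⁅x⁆])
  ... | 𝒯[E─f⁅e⁆] | no e≢x =
    IsTangle.T4 𝒯-tangle e (proj₁ (∈E'⁻ e∈E' e≢x))
      (subst 𝒯 (cong (E ─_) (expand-∉ (λ x∈⁅e⁆ → e≢x (sym (x∈⁅y⁆⇒x≡y e x∈⁅e⁆))))) 𝒯[E─f⁅e⁆])

lemma3p2 : {N : ℕ} (K : ConnectivitySystem N) (k : ℤ) (𝒯 : Subset N → Set)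
    → IsRobustTangle (ConnectivitySystem.E K) (ConnectivitySystem.conn K) k 𝒯
    → (X : Subset N) → 𝒯 X
    → (x : Fin N) → x ∉ ConnectivitySystem.E K
    → IsRobustTangle (∘-ground (ConnectivitySystem.E K) X x)
                     (∘-conn (ConnectivitySystem.conn K) X x) k
                     (∘-tangle (ConnectivitySystem.E K) 𝒯 X x)
lemma3p2 K k 𝒯 𝒯-robust X 𝒯X x x∉E =
  Pullback.isRobustTangle 𝒯-robust expand expand-∪ expand-ground expand-─
    (expand-removal-∉ (IsRobustTangle.tangle 𝒯-robust) 𝒯X) conn'≡conn∘expand 𝒯'≡
  where
  open ConnectivitySystem K
  open Expansion E X x (IsTangle.members⊆E (IsRobustTangle.tangle 𝒯-robust) X 𝒯X) x∉E

  conn'≡conn∘expand : ∀ A → ∘-conn conn X x A ≡ conn (expand A)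
  conn'≡conn∘expand A = sym (if-float conn (lookup A x))

  𝒯'≡ : ∀ A → ∘-tangle E 𝒯 X x A ≡ (A ⊆ E' × 𝒯 (expand A))
  𝒯'≡ A = cong (A ⊆ E' ×_) (sym (if-float 𝒯 (lookup A x)))
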